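{- Let $\mathbf P=(P,\leq)$ be a poset, $a,b\in P$ with $a\leq b$, $x\in[a,b]$ and $y\in P$. Assume that $(a,y,b)$ is a modular triple of $\mathbf P$ and that $e$ is the greatest element of $L\big(U(a,y),b\big)=LU\big(a,L(y,b)\big)$. Then the following are equivalent: (i) $e\in R(a,b,x)$; (ii) $L\Big(U\big(a,L(y,b)\big),x\Big)=L(a)$ and $U\Big(x,L\big(U(a,y),b\big)\Big)=U(b)$.
   Context: In a poset $(P,\leq)$, for $A\subseteq P$ let $L(A)=\{p\in P\mid p\leq a\text{ for all }a\in A\}$ and $U(A)=\{p\in P\mid a\leq p\text{ for all }a\in A\}$. One writes $L(a)$ for $L(\{a\})$, $L(a,b)$ for $L(\{a,b\})$, $L(A,a)$ for $L(A\cup\{a\})$, $U(a,A)$ for $U(\{a\}\cup A)$, $LU(A)$ for $L(U(A))$, and similarly. For $a\leq b$ and $x\in[a,b]$, an element $z\in[a,b]$ is a relative complement of $x$ in $[a,b]$ if $U(x,z)=U(b)$ and $L(x,z)=L(a)$; $R(a,b,x)$ denotes the set of all such relative complements. A triple $(p,q,r)$ of elements of $P$ is a modular triple of $\mathbf P$ if $p\leq r$ and $L\big(U(p,q),r\big)=LU\big(p,L(q,r)\big)$. -}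

module Defs where

open import Level using (Level; _⊔_; suc)
open import Data.Product using (_×_; _,_)
open import Data.Sum using (_⊎_)
open import Relation.Binary.Bundles using (Poset)

module _ {c ℓ₁ ℓ₂ : Level} (𝐏 : Poset c ℓ₁ ℓ₂) where
  open Poset 𝐏

  Subset : Set (suc (c ⊔ ℓ₁ ⊔ ℓ₂))
  Subset = Carrier → Set (c ⊔ ℓ₁ ⊔ ℓ₂)

  ｛_｝ : Carrier → Subset
  ｛ a ｝ = λ z → Level.Lift (c ⊔ ℓ₂) (z ≈ a)

  _∪_ : Subset → Subset → Subset
  A ∪ B = λ z → A z ⊎ B z

  _∈_ : Carrier → Subset → Set (c ⊔ ℓ₁ ⊔ ℓ₂)
  x ∈ A = A x

  _≐_ : Subset → Subset → Set (c ⊔ ℓ₁ ⊔ ℓ₂)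
  A ≐ B = ∀ z → (A z → B z) × (B z → A z)

  L : Subset → Subset
  L A = λ p → ∀ a → A a → p ≤ a

  U : Subset → Subset
  U A = λ p → ∀ a → A a → a ≤ p

  IsGreatest : Subset → Carrier → Set (c ⊔ ℓ₁ ⊔ ℓ₂)
  IsGreatest S e = (e ∈ S) × (∀ s → s ∈ S → s ≤ e)

  _∈[_,_] : Carrier → Carrier → Carrier → Set ℓ₂
  x ∈[ a , b ] = (a ≤ x) × (x ≤ b)

  R : Carrier → Carrier → Carrier → Subset
  R a b x = λ z → (z ∈[ a , b ]) × ((U (｛ x ｝ ∪ ｛ z ｝) ≐ U ｛ b ｝) × (L (｛ x ｝ ∪ ｛ z ｝) ≐ L ｛ a ｝))

  ModularTriple : Carrier → Carrier → Carrier → Set (c ⊔ ℓ₁ ⊔ ℓ₂)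
  ModularTriple p q r =
    (p ≤ r) × (L (U (｛ p ｝ ∪ ｛ q ｝) ∪ ｛ r ｝) ≐ L (U (｛ p ｝ ∪ L (｛ q ｝ ∪ ｛ r ｝))))

{-# OPTIONS --safe #-}
-- Both conditions of (ii) only mention e through sets it determines: LU(a, L(y,b)) is
-- L(U(a,y), b) by modularity, a down-set with greatest element e, hence equal to L(e);
-- and an upper cone U(x, S) only sees the greatest element of S.  So (ii) says exactly
-- L(x,e) = L(a) and U(x,e) = U(b), while a ≤ e ≤ b holds because a ≤ b puts a in
-- L(U(a,y), b).
module Submission where

open import Defs
open import Level using (Level; lift)
open import Data.Product using (_×_; _,_; proj₁; proj₂)
open import Data.Sum using (inj₁; inj₂)
open import Function.Bundles using (_⇔_; mk⇔)
open import Relation.Binary.Bundles using (Poset)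

module _ {c ℓ₁ ℓ₂ : Level} (𝐏 : Poset c ℓ₁ ℓ₂) where
  open Poset 𝐏

  ≐-sym : {A B : Subset 𝐏} → _≐_ 𝐏 A B → _≐_ 𝐏 B A
  ≐-sym A≐B z = proj₂ (A≐B z) , proj₁ (A≐B z)

  ≐-trans : {A B C : Subset 𝐏} → _≐_ 𝐏 A B → _≐_ 𝐏 B C → _≐_ 𝐏 A C
  ≐-trans A≐B B≐C z = (λ h → proj₁ (B≐C z) (proj₁ (A≐B z) h))
                    , (λ h → proj₂ (A≐B z) (proj₂ (B≐C z) h))

  L-∪-comm : (A B : Subset 𝐏) → _≐_ 𝐏 (L 𝐏 (_∪_ 𝐏 A B)) (L 𝐏 (_∪_ 𝐏 B A))
  L-∪-comm A B z = swap , swap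
    where
    swap : ∀ {A B} → L 𝐏 (_∪_ 𝐏 A B) z → L 𝐏 (_∪_ 𝐏 B A) z
    swap h w (inj₁ w∈B) = h w (inj₂ w∈B)
    swap h w (inj₂ w∈A) = h w (inj₁ w∈A)

  L-∪-congˡ : {A A′ : Subset 𝐏} (C : Subset 𝐏) →
              _≐_ 𝐏 (L 𝐏 A) (L 𝐏 A′) → _≐_ 𝐏 (L 𝐏 (_∪_ 𝐏 A C)) (L 𝐏 (_∪_ 𝐏 A′ C))
  L-∪-congˡ C LA≐LA′ z = replace (proj₁ (LA≐LA′ z)) , replace (proj₂ (LA≐LA′ z))
    where
    replace : ∀ {A A′} → (L 𝐏 A z → L 𝐏 A′ z) → L 𝐏 (_∪_ 𝐏 A C) z → L 𝐏 (_∪_ 𝐏 A′ C) z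
    replace f h w (inj₁ w∈A′) = f (λ v v∈A → h v (inj₁ v∈A)) w w∈A′
    replace f h w (inj₂ w∈C)  = h w (inj₂ w∈C)

  U-∪-congʳ : (C : Subset 𝐏) {S S′ : Subset 𝐏} →
              _≐_ 𝐏 (U 𝐏 S) (U 𝐏 S′) → _≐_ 𝐏 (U 𝐏 (_∪_ 𝐏 C S)) (U 𝐏 (_∪_ 𝐏 C S′))
  U-∪-congʳ C US≐US′ z = replace (proj₁ (US≐US′ z)) , replace (proj₂ (US≐US′ z))
    where
    replace : ∀ {S S′} → (U 𝐏 S z → U 𝐏 S′ z) → U 𝐏 (_∪_ 𝐏 C S) z → U 𝐏 (_∪_ 𝐏 C S′) z
    replace f h w (inj₁ w∈C)  = h w (inj₁ w∈C)
    replace f h w (inj₂ w∈S′) = f (λ v v∈S → h v (inj₂ v∈S)) w w∈S′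

  L-greatest : (B : Subset 𝐏) {e : Carrier} →
               IsGreatest 𝐏 (L 𝐏 B) e → _≐_ 𝐏 (L 𝐏 B) (L 𝐏 (｛_｝ 𝐏 e))
  L-greatest B (e∈LB , e-max) z =
      (λ z∈LB w (lift w≈e) → ≤-respʳ-≈ (Eq.sym w≈e) (e-max z z∈LB))
    , (λ z∈Le w w∈B → trans (z∈Le _ (lift Eq.refl)) (e∈LB w w∈B))

  U-greatest : (S : Subset 𝐏) {e : Carrier} →
               IsGreatest 𝐏 S e → _≐_ 𝐏 (U 𝐏 S) (U 𝐏 (｛_｝ 𝐏 e))
  U-greatest S (e∈S , e-max) z =
      (λ z∈US w (lift w≈e) → ≤-respˡ-≈ (Eq.sym w≈e) (z∈US _ e∈S))
    , (λ z∈Ue w w∈S → trans (e-max w w∈S) (z∈Ue _ (lift Eq.refl)))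

  greatest-∈[,] : {a b e : Carrier} (Y : Subset 𝐏) → a ≤ b →
                  IsGreatest 𝐏 (L 𝐏 (_∪_ 𝐏 (U 𝐏 (_∪_ 𝐏 (｛_｝ 𝐏 a) Y)) (｛_｝ 𝐏 b))) e →
                  _∈[_,_] 𝐏 e a b
  greatest-∈[,] {a} {b} Y a≤b (e∈S , e-max) = e-max a a∈S , e∈S b (inj₂ (lift Eq.refl))
    where
    a∈S : L 𝐏 (_∪_ 𝐏 (U 𝐏 (_∪_ 𝐏 (｛_｝ 𝐏 a) Y)) (｛_｝ 𝐏 b)) a
    a∈S w (inj₁ w∈U)        = w∈U a (inj₁ (lift Eq.refl))
    a∈S w (inj₂ (lift w≈b)) = ≤-respʳ-≈ (Eq.sym w≈b) a≤b

theorem6 : ∀ {c ℓ₁ ℓ₂ : Level} (𝐏 : Poset c ℓ₁ ℓ₂) →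
    let open Poset 𝐏 in
    (a b x y e : Carrier) →
    a ≤ b →
    _∈[_,_] 𝐏 x a b →
    ModularTriple 𝐏 a y b →
    IsGreatest 𝐏 (L 𝐏 (_∪_ 𝐏 (U 𝐏 (_∪_ 𝐏 (｛_｝ 𝐏 a) (｛_｝ 𝐏 y))) (｛_｝ 𝐏 b))) e →
    (R 𝐏 a b x e ⇔
      (_≐_ 𝐏 (L 𝐏 (_∪_ 𝐏 (U 𝐏 (_∪_ 𝐏 (｛_｝ 𝐏 a) (L 𝐏 (_∪_ 𝐏 (｛_｝ 𝐏 y) (｛_｝ 𝐏 b))))) (｛_｝ 𝐏 x))) (L 𝐏 (｛_｝ 𝐏 a))
       × _≐_ 𝐏 (U 𝐏 (_∪_ 𝐏 (｛_｝ 𝐏 x) (L 𝐏 (_∪_ 𝐏 (U 𝐏 (_∪_ 𝐏 (｛_｝ 𝐏 a) (｛_｝ 𝐏 y))) (｛_｝ 𝐏 b))))) (U 𝐏 (｛_｝ 𝐏 b))))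
theorem6 𝐏 a b x y e a≤b _ (_ , modular) e-greatest = mk⇔
    (λ (_ , Uxe≐Ub , Lxe≐La) → ≐-trans 𝐏 lower Lxe≐La , ≐-trans 𝐏 upper Uxe≐Ub)
    (λ (lower≐La , upper≐Ub) →
       greatest-∈[,] 𝐏 (｛_｝ 𝐏 y) a≤b e-greatest
       , ≐-trans 𝐏 (≐-sym 𝐏 upper) upper≐Ub
       , ≐-trans 𝐏 (≐-sym 𝐏 lower) lower≐La)
  where
  S : Subset 𝐏
  S = L 𝐏 (_∪_ 𝐏 (U 𝐏 (_∪_ 𝐏 (｛_｝ 𝐏 a) (｛_｝ 𝐏 y))) (｛_｝ 𝐏 b))

  T : Subset 𝐏
  T = U 𝐏 (_∪_ 𝐏 (｛_｝ 𝐏 a) (L 𝐏 (_∪_ 𝐏 (｛_｝ 𝐏 y) (｛_｝ 𝐏 b))))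

  lower : _≐_ 𝐏 (L 𝐏 (_∪_ 𝐏 T (｛_｝ 𝐏 x))) (L 𝐏 (_∪_ 𝐏 (｛_｝ 𝐏 x) (｛_｝ 𝐏 e)))
  lower = ≐-trans 𝐏
    (L-∪-congˡ 𝐏 (｛_｝ 𝐏 x) (≐-trans 𝐏 (≐-sym 𝐏 modular) (L-greatest 𝐏 _ e-greatest)))
    (L-∪-comm 𝐏 (｛_｝ 𝐏 e) (｛_｝ 𝐏 x))

  upper : _≐_ 𝐏 (U 𝐏 (_∪_ 𝐏 (｛_｝ 𝐏 x) S)) (U 𝐏 (_∪_ 𝐏 (｛_｝ 𝐏 x) (｛_｝ 𝐏 e)))
  upper = U-∪-congʳ 𝐏 (｛_｝ 𝐏 x) (U-greatest 𝐏 S e-greatest)
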